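{- If $\mathbb{H}$ is a perfect supported heterogeneous m-algebra, then $\mathbb{H}_+$ is a supported two-sorted n-frame.
   Context: A heterogeneous m-algebra is a structure $\mathbb{H} = (\mathbb{A}, \mathbb{B}, [\ni]^{\mathbb{H}}, \langle\not\ni\rangle^{\mathbb{H}}, \langle\nu\rangle^{\mathbb{H}}, [\nu^c]^{\mathbb{H}})$ such that $\mathbb{A}$ and $\mathbb{B}$ are Boolean algebras, $\langle\nu\rangle^{\mathbb{H}}, [\nu^c]^{\mathbb{H}}: \mathbb{B}\to\mathbb{A}$ are finitely join-preserving and finitely meet-preserving respectively, and $[\ni]^{\mathbb{H}}, \langle\not\ni\rangle^{\mathbb{H}}: \mathbb{A}\to\mathbb{B}$ are finitely meet-preserving and finitely join-preserving respectively. It is complete if $\mathbb{A},\mathbb{B}$ are complete and these operations enjoy the complete versions of these preservation properties; perfect if moreover $\mathbb{A},\mathbb{B}$ are perfect, so that $\mathbb{H} = (\mathcal{P}(X), \mathcal{P}(Y), [\ni]^{\mathbb{H}}, \langle\not\ni\rangle^{\mathbb{H}}, \langle\nu\rangle^{\mathbb{H}}, [\nu^c]^{\mathbb{H}})$. It is supported if $\langle\nu\rangle^{\mathbb{H}}[\ni]^{\mathbb{H}}a = [\nu^c]^{\mathbb{H}}\langle\not\ni\rangle^{\mathbb{H}}a$ for every $a\in\mathbb{A}$. For such a perfect $\mathbb{H}$, its associated two-sorted n-frame is $\mathbb{H}_+ = (X, Y, R_\ni, R_{\not\ni}, R_\nu, R_{\nu^c})$ where $R_\ni\subseteq Y\times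 X$ is given by $yR_\ni x$ iff $y\notin [\ni]^{\mathbb{H}}x^c$; $R_{\not\ni}\subseteq Y\times X$ relates $y$ and $x$ iff $y\in\langle\not\ni\rangle^{\mathbb{H}}\{x\}$; $R_\nu\subseteq X\times Y$ is given by $xR_\nu y$ iff $x\in\langle\nu\rangle^{\mathbb{H}}\{y\}$; $R_{\nu^c}\subseteq X\times Y$ is given by $xR_{\nu^c}y$ iff $x\notin[\nu^c]^{\mathbb{H}}y^c$. A two-sorted n-frame $(X,Y,R_\ni,R_{\not\ni},R_\nu,R_{\nu^c})$ (with $X,Y$ nonempty, $R_\ni,R_{\not\ni}\subseteq Y\times X$, $R_\nu,R_{\nu^c}\subseteq X\times Y$) is supported if for every $D\subseteq X$, $R_{\nu}^{ -1}[(R_{\ni}^{ -1}[D^c])^c] = (R_{\nu^c}^{ -1}[(R_{\not\ni}^{ -1}[D])^c])^c$. -}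

module Defs where

open import Level using (0ℓ)
open import Data.Product using (Σ-syntax; _×_; _,_)
open import Relation.Binary.PropositionalEquality using (_≡_)
open import Relation.Unary using (Pred; _≐_; ∁; ⋃; ⋂)

-- Subsets of a (small) type: the powerset algebra P(X) is modelled by
-- Pred X 0ℓ, with equality of subsets being extensional equality _≐_.

CompletelyJoinPreserving : {X Y : Set} → (Pred X 0ℓ → Pred Y 0ℓ) → Set₁
CompletelyJoinPreserving {X} f =
  (I : Set) (F : I → Pred X 0ℓ) → f (⋃ I F) ≐ ⋃ I (λ i → f (F i))

CompletelyMeetPreserving : {X Y : Set} → (Pred X 0ℓ → Pred Y 0ℓ) → Set₁
CompletelyMeetPreserving {X} f =
  (I : Set) (F : I → Pred X 0ℓ) → f (⋂ I F) ≐ ⋂ I (λ i → f (F i))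

-- A perfect heterogeneous m-algebra  (P(X), P(Y), [∋], ⟨∌⟩, ⟨ν⟩, [νᶜ]).
-- X and Y are nonempty (as for the dual two-sorted n-frames).
record PerfectHMAlgebra : Set₁ where
  field
    X Y       : Set
    x₀        : X
    y₀        : Y
    box∋      : Pred X 0ℓ → Pred Y 0ℓ
    dia∌      : Pred X 0ℓ → Pred Y 0ℓ
    diaν      : Pred Y 0ℓ → Pred X 0ℓ
    boxνc     : Pred Y 0ℓ → Pred X 0ℓ
    box∋-cong  : ∀ {a b} → a ≐ b → box∋ a ≐ box∋ b
    dia∌-cong  : ∀ {a b} → a ≐ b → dia∌ a ≐ dia∌ b
    diaν-cong  : ∀ {a b} → a ≐ b → diaν a ≐ diaν b
    boxνc-cong : ∀ {a b} → a ≐ b → boxνc a ≐ boxνc b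
    box∋-meet  : CompletelyMeetPreserving box∋
    dia∌-join  : CompletelyJoinPreserving dia∌
    diaν-join  : CompletelyJoinPreserving diaν
    boxνc-meet : CompletelyMeetPreserving boxνc

SupportedAlg : PerfectHMAlgebra → Set₁
SupportedAlg H = (a : Pred X 0ℓ) → diaν (box∋ a) ≐ boxνc (dia∌ a)
  where open PerfectHMAlgebra H

record NFrame : Set₁ where
  field
    X Y  : Set
    x₀   : X
    y₀   : Y
    R∋   : Y → X → Set
    R∌   : Y → X → Set
    Rν   : X → Y → Set
    Rνc  : X → Y → Set

preimage : {A B : Set} → (A → B → Set) → Pred B 0ℓ → Pred A 0ℓ
preimage {B = B} R S a = Σ[ b ∈ B ] (R a b × S b)

SupportedFrame : NFrame → Set₁
SupportedFrame F =
  (D : Pred X 0ℓ) →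
    preimage Rν (∁ (preimage R∋ (∁ D)))
      ≐ ∁ (preimage Rνc (∁ (preimage R∌ D)))
  where open NFrame F

⟦_⟧ : {X : Set} → X → Pred X 0ℓ
⟦ x ⟧ = λ x' → x' ≡ x

co⟦_⟧ : {X : Set} → X → Pred X 0ℓ
co⟦ x ⟧ = ∁ ⟦ x ⟧

_₊ : PerfectHMAlgebra → NFrame
H ₊ = record
  { X = X ; Y = Y ; x₀ = x₀ ; y₀ = y₀
  ; R∋  = λ y x → ¬' (box∋ co⟦ x ⟧ y)
  ; R∌  = λ y x → dia∌ ⟦ x ⟧ y
  ; Rν  = λ x y → diaν ⟦ y ⟧ x
  ; Rνc = λ x y → ¬' (boxνc co⟦ y ⟧ x)
  }
  where
    open PerfectHMAlgebra H
    open import Relation.Nullary using (¬_)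
    ¬' : Set → Set
    ¬' P = ¬ P

-- In a powerset algebra every set is the join of the singletons
-- below it and, classically, the meet of the co-singletons above it. Hence a
-- completely join-preserving f is the preimage map of its atomic relation,
-- f a = R⁻¹[a], and a completely meet-preserving g is its dual,
-- g a = (R⁻¹[aᶜ])ᶜ. Rewriting both sides of the algebraic support condition
-- at a = D in these terms gives exactly the support condition of H₊.
module Submission where

open import Defs
open import Level using (0ℓ)
open import Axiom.ExcludedMiddle using (ExcludedMiddle)
open import Axiom.DoubleNegationElimination using (em⇒dne)
open import Data.Product using (Σ; _,_; proj₁)
open import Relation.Nullary using (¬_)
open import Relation.Binary.PropositionalEquality using (refl)
open import Relation.Unary using (Pred; _≐_; ∁; ⋃; ⋂)
open import Relation.Unary.Properties using (≐-sym; ≐-trans)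
open import Relation.Unary.Relation.Binary.Equality using (≐-setoid)
import Relation.Binary.Reasoning.Setoid as SetoidReasoning

private
  variable
    A B : Set

∁-cong : {P Q : Pred A 0ℓ} → P ≐ Q → ∁ P ≐ ∁ Q
∁-cong (P⊆Q , Q⊆P) = (λ ¬P Q → ¬P (Q⊆P Q)) , (λ ¬Q P → ¬Q (P⊆Q P))

preimage-cong : (R : A → B → Set) {S T : Pred B 0ℓ} → S ≐ T → preimage R S ≐ preimage R T
preimage-cong R (S⊆T , T⊆S) =
  (λ { (b , r , s) → b , r , S⊆T s }) , (λ { (b , r , t) → b , r , T⊆S t })

⋃-singletons : (a : Pred A 0ℓ) → a ≐ ⋃ (Σ A a) (λ p → ⟦ proj₁ p ⟧)
⋃-singletons a = (λ {x} x∈a → (x , x∈a) , refl) , λ { ((_ , x∈a) , refl) → x∈a }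

⋂-co-singletons : ExcludedMiddle 0ℓ → (a : Pred A 0ℓ) → a ≐ ⋂ (Σ A (∁ a)) (λ p → co⟦ proj₁ p ⟧)
⋂-co-singletons em a =
  (λ x∈a → λ { (_ , x∉a) refl → x∉a x∈a }) ,
  (λ {x} x∈⋂ → em⇒dne em (λ x∉a → x∈⋂ (x , x∉a) refl))

module _ {f : Pred A 0ℓ → Pred B 0ℓ}
         (f-cong : ∀ {a b} → a ≐ b → f a ≐ f b) (f-join : CompletelyJoinPreserving f) where

  completelyJoinPreserving⇒preimage : (a : Pred A 0ℓ) → f a ≐ preimage (λ y x → f ⟦ x ⟧ y) a
  completelyJoinPreserving⇒preimage a =
    ≐-trans (f-cong (⋃-singletons a))
      (≐-trans (f-join (Σ A a) (λ p → ⟦ proj₁ p ⟧))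
        ((λ { ((x , x∈a) , y∈fx) → x , y∈fx , x∈a }) ,
         (λ { (x , y∈fx , x∈a) → (x , x∈a) , y∈fx })))

module _ (em : ExcludedMiddle 0ℓ) {g : Pred A 0ℓ → Pred B 0ℓ}
         (g-cong : ∀ {a b} → a ≐ b → g a ≐ g b) (g-meet : CompletelyMeetPreserving g) where

  completelyMeetPreserving⇒∁preimage∁ :
    (a : Pred A 0ℓ) → g a ≐ ∁ (preimage (λ y x → ¬ g co⟦ x ⟧ y) (∁ a))
  completelyMeetPreserving⇒∁preimage∁ a =
    ≐-trans (g-cong (⋂-co-singletons em a))
      (≐-trans (g-meet (Σ A (∁ a)) (λ p → co⟦ proj₁ p ⟧))
        ((λ y∈⋂ → λ { (x , y∉gx , x∉a) → y∉gx (y∈⋂ (x , x∉a)) }) ,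
         (λ y∉pre → λ { (x , x∉a) → em⇒dne em (λ y∉gx → y∉pre (x , y∉gx , x∉a)) })))

lemma2 : ExcludedMiddle 0ℓ → (H : PerfectHMAlgebra) → SupportedAlg H → SupportedFrame (H ₊)
lemma2 em H supported D = begin
  preimage Rν (∁ (preimage R∋ (∁ D)))
    ≈⟨ preimage-cong Rν (≐-sym (box∋-as-preimage D)) ⟩
  preimage Rν (box∋ D)
    ≈⟨ ≐-sym (diaν-as-preimage (box∋ D)) ⟩
  diaν (box∋ D)
    ≈⟨ supported D ⟩
  boxνc (dia∌ D)
    ≈⟨ boxνc-as-preimage (dia∌ D) ⟩
  ∁ (preimage Rνc (∁ (dia∌ D)))
    ≈⟨ ∁-cong (preimage-cong Rνc (∁-cong (dia∌-as-preimage D))) ⟩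
  ∁ (preimage Rνc (∁ (preimage R∌ D))) ∎
  where
  open PerfectHMAlgebra H
  open NFrame (H ₊) using (R∋; R∌; Rν; Rνc)
  open SetoidReasoning (≐-setoid X 0ℓ)

  box∋-as-preimage : (a : Pred X 0ℓ) → box∋ a ≐ ∁ (preimage R∋ (∁ a))
  box∋-as-preimage = completelyMeetPreserving⇒∁preimage∁ em box∋-cong box∋-meet

  boxνc-as-preimage : (b : Pred Y 0ℓ) → boxνc b ≐ ∁ (preimage Rνc (∁ b))
  boxνc-as-preimage = completelyMeetPreserving⇒∁preimage∁ em boxνc-cong boxνc-meet

  dia∌-as-preimage : (a : Pred X 0ℓ) → dia∌ a ≐ preimage R∌ a
  dia∌-as-preimage = completelyJoinPreserving⇒preimage dia∌-cong dia∌-join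

  diaν-as-preimage : (b : Pred Y 0ℓ) → diaν b ≐ preimage Rν b
  diaν-as-preimage = completelyJoinPreserving⇒preimage diaν-cong diaν-join
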